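{- Let $a_{2m}$ be the number of convex polyominoes of half-perimeter $2m$ invariant under rotation by $90^\circ$. Then $a_2=1$ and $a_{2m}=2^{m-2}$ for $m\ge2$.
   Context: A polyomino is a finite edge-connected union of unit cells of the square lattice, up to translation; convex means its intersection with every horizontal and vertical line is connected. Half-perimeter is width plus height. Invariance under a rotation means the rotation maps the polyomino to a translate of itself. -}

module Defs where

open import Data.Nat using (ℕ; zero; suc; _+_; _*_; _∸_; _≤_; _<_)
open import Data.Bool using (Bool; true)
open import Data.Fin using (fromℕ<)
open import Data.Vec using (Vec; lookup)
open import Data.Product using (Σ; ∃; _×_; _,_)
open import Data.Sum using (_⊎_)
open import Data.List using (List; length)
open import Data.List.Membership.Propositional using (_∈_)
open import Data.List.Relation.Unary.Unique.Propositional using (Unique)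
open import Function.Bundles using (_⇔_)
open import Relation.Binary.PropositionalEquality using (_≡_)

-- A finite set of unit cells inside a w × h box, given row by row:
-- the cell with lower-left corner (x , y) (0 ≤ x < w, 0 ≤ y < h)
-- is present iff entry x of row y is true.
Grid : ℕ → ℕ → Set
Grid w h = Vec (Vec Bool w) h

-- A translation class of finite cell sets, represented by its normal form:
-- the set translated so that its bounding box is exactly [0,w) × [0,h)
-- (tightness is imposed by 'Tight' below).
Shape : Set
Shape = Σ ℕ λ w → Σ ℕ λ h → Grid w h

width : Shape → ℕ
width (w , _ , _) = w

height : Shape → ℕ
height (_ , h , _) = h

halfPerimeter : Shape → ℕ
halfPerimeter s = width s + height s

Cell : Shape → ℕ → ℕ → Set
Cell (w , h , g) x y =
  Σ (x < w) λ px → Σ (y < h) λ py → lookup (lookup g (fromℕ< py)) (fromℕ< px) ≡ true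

-- The bounding box of the cells is exactly [0,w) × [0,h) (forces w,h ≥ 1,
-- so the set is nonempty, and makes the representative of a translation
-- class unique).
Tight : Shape → Set
Tight s =
  (∃ λ x → Cell s x 0) × (∃ λ x → Cell s x (height s ∸ 1)) ×
  (∃ λ y → Cell s 0 y) × (∃ λ y → Cell s (width s ∸ 1) y)

Adj : ℕ × ℕ → ℕ × ℕ → Set
Adj (x , y) (x' , y') =
  (x ≡ x' × (suc y ≡ y' ⊎ y ≡ suc y')) ⊎ (y ≡ y' × (suc x ≡ x' ⊎ x ≡ suc x'))

data Path (s : Shape) : ℕ × ℕ → ℕ × ℕ → Set where
  here : ∀ {x y} → Cell s x y → Path s (x , y) (x , y)
  step : ∀ {x y q r} → Cell s x y → Adj (x , y) q → Path s q r → Path s (x , y) r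

EdgeConnected : Shape → Set
EdgeConnected s = ∀ x y x' y' → Cell s x y → Cell s x' y' → Path s (x , y) (x' , y')

IsPolyomino : Shape → Set
IsPolyomino s = Tight s × EdgeConnected s

Convex : Shape → Set
Convex s =
  (∀ y x₁ x x₂ → Cell s x₁ y → Cell s x₂ y → x₁ ≤ x → x ≤ x₂ → Cell s x y) ×
  (∀ x y₁ y y₂ → Cell s x y₁ → Cell s x y₂ → y₁ ≤ y → y ≤ y₂ → Cell s x y)

-- Invariance under rotation by 90°: the rotation (x , y) ↦ (-y , x),
-- followed by the translation bringing the image back to normal form,
-- sends the cell (x , y) of a w × h shape to (h-1-y , x) of an h × w shape.
-- So the rotated normal form has cells (x' , y') with Cell s y' (h-1-x');
-- invariance (up to translation) means this normal form equals s.
RotInvariant90 : Shape → Set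
RotInvariant90 s =
  width s ≡ height s ×
  (∀ x y → x < width s → y < height s →
     Cell s x y ⇔ Cell s y (height s ∸ 1 ∸ x))

ConvexRotInv : ℕ → Shape → Set
ConvexRotInv n s = halfPerimeter s ≡ n × IsPolyomino s × Convex s × RotInvariant90 s

HasCount : (Shape → Set) → ℕ → Set
HasCount P k =
  Σ (List Shape) λ L → Unique L × length L ≡ k × (∀ s → (s ∈ L ⇔ P s))

-- Put the polyomino in the box [0, n]², n = m - 1.  A convex polyomino there is the box minus
-- four monotone staircases, one per corner, and invariance under the quarter turn
-- (x , y) ↦ (y , n ∸ x) makes three of them the images of the south-west one.  That one is
-- recorded by indent y, the least x with a cell in rows ≤ y: a non-increasing sequence that
-- vanishes from row n ∸ indent 0 on, and (x , y) is a cell iff it and its three rotated images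
-- (x′ , y′) all satisfy indent y′ ≤ x′.  Conversely every such sequence cuts out a
-- rotation-invariant convex polyomino (consecutive rows meet, which gives connectivity), and
-- different sequences cut out different ones.  For n ≥ 1 the sequences for n + 1 arise from
-- those for n by either repeating or incrementing indent 0, so there are 2 ^ (n - 1) of them.

module Submission where

open import Defs
open import Data.Bool using (true; false)
open import Data.Bool.Properties using () renaming (_≟_ to _≟ᵇ_)
open import Data.Empty using (⊥-elim)
open import Data.Fin using (toℕ; fromℕ<)
open import Data.Fin.Properties using (toℕ<n; toℕ-fromℕ<; fromℕ<-toℕ)
open import Data.List using (List; []; _∷_; _++_; length; map)
open import Data.List.Properties using (length-++; length-map)
open import Data.List.Membership.Propositional using (_∈_)
open import Data.List.Membership.Propositional.Properties using (∈-map⁻)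
import Data.List.Relation.Unary.All as All
import Data.List.Relation.Unary.All.Properties as Allₚ
open import Data.List.Relation.Unary.AllPairs as AllPairs using (AllPairs; []; _∷_)
import Data.List.Relation.Unary.AllPairs.Properties as AllPairsₚ
open import Data.List.Relation.Unary.Any as Any using (Any; here)
import Data.List.Relation.Unary.Any.Properties as Anyₚ
open import Data.List.Relation.Unary.Unique.Propositional using (Unique)
open import Data.Nat using (ℕ; zero; suc; _+_; _*_; _∸_; _^_; _≤_; _<_; _⊓_; z≤n; s≤s; s≤s⁻¹; _≤?_; _<?_)
open import Data.Nat.Properties
open import Data.Product using (∃; _×_; _,_; proj₁; proj₂)
open import Data.Sum using (_⊎_; inj₁; inj₂)
open import Data.Vec using (Vec; lookup; tabulate)
open import Data.Vec.Properties using (lookup∘tabulate; tabulate∘lookup; tabulate-cong)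
open import Function using (_∘_)
open import Function.Bundles using (_⇔_; mk⇔; Equivalence)
open import Relation.Binary.PropositionalEquality
open import Relation.Nullary using (¬_; Dec; yes; no; does)
open import Relation.Nullary.Decidable using (map′; _×-dec_; dec-true)
import Relation.Unary as U

least : {P : ℕ → Set} → U.Decidable P → ℕ → ℕ
least P? zero    = zero
least P? (suc b) with P? zero
... | yes _ = zero
... | no  _ = suc (least (P? ∘ suc) b)

least-minimal : ∀ {P : ℕ → Set} (P? : U.Decidable P) b {x} → x < least P? b → ¬ P x
least-minimal P? (suc b) x<ℓ px with P? zero
least-minimal P? (suc b) ()         px | yes _
least-minimal P? (suc b) {zero}  _          p0 | no ¬p0 = ¬p0 p0
least-minimal P? (suc b) {suc x} (s≤s x<ℓ) px | no _   = least-minimal (P? ∘ suc) b x<ℓ px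

least-witness : ∀ {P : ℕ → Set} (P? : U.Decidable P) b → least P? b < b → P (least P? b)
least-witness P? (suc b) ℓ<b with P? zero
... | yes p0 = p0
... | no  _  = least-witness (P? ∘ suc) b (s≤s⁻¹ ℓ<b)

least-≤ : ∀ {P : ℕ → Set} (P? : U.Decidable P) b {x} → P x → least P? b ≤ x
least-≤ P? b px = ≮⇒≥ (λ x<ℓ → least-minimal P? b x<ℓ px)

<-least : ∀ {P : ℕ → Set} (P? : U.Decidable P) {b x} →
          x < b → (∀ {y} → y ≤ x → ¬ P y) → x < least P? b
<-least P? {b} x<b none = ≰⇒> (λ ℓ≤x → none ℓ≤x (least-witness P? b (≤-<-trans ℓ≤x x<b)))

IsInterval : (ℕ → Set) → Set
IsInterval P = ∀ i j k → P i → P k → i ≤ j → j ≤ k → P j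

interval-gap : ∀ {P : ℕ → Set} → U.Decidable P → IsInterval P → ∀ {x} → ¬ P x →
               (∀ {y} → y ≤ x → ¬ P y) ⊎ (∀ {y} → x ≤ y → ¬ P y)
interval-gap P? interval {x} ¬px with least P? (suc x) <? suc x
... | yes ℓ<1+x = inj₂ λ {y} x≤y py →
  ¬px (interval _ x y (least-witness P? (suc x) ℓ<1+x) py (s≤s⁻¹ ℓ<1+x) x≤y)
... | no  ℓ≮1+x = inj₁ λ y≤x → least-minimal P? (suc x) (≤-trans (s≤s y≤x) (≮⇒≥ ℓ≮1+x))

RowConvex ColumnConvex : Shape → Set
RowConvex s = ∀ y → IsInterval (λ x → Cell s x y)
ColumnConvex s = ∀ x → IsInterval (λ y → Cell s x y)

cell? : ∀ s x y → Dec (Cell s x y)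
cell? (w , h , G) x y with x <? w | y <? h
... | no x≮w  | _       = no (x≮w ∘ proj₁)
... | yes _   | no y≮h  = no (y≮h ∘ proj₁ ∘ proj₂)
... | yes x<w | yes y<h = map′ (λ e → x<w , y<h , e) (proj₂ ∘ proj₂)
                               (lookup (lookup G (fromℕ< y<h)) (fromℕ< x<w) ≟ᵇ true)

Cell⇒<height : ∀ {s x y} → Cell s x y → y < height s
Cell⇒<height {w , h , G} (_ , y<h , _) = y<h

tabulateGrid : {P : ℕ → ℕ → Set} → (∀ x y → Dec (P x y)) → ∀ w h → Grid w h
tabulateGrid P? w h = tabulate λ j → tabulate λ i → does (P? (toℕ i) (toℕ j))

module _ {P : ℕ → ℕ → Set} (P? : ∀ x y → Dec (P x y)) {w h : ℕ} where

  private
    does-true : ∀ {A : Set} (a? : Dec A) → does a? ≡ true → A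
    does-true (yes a) _ = a

    Vec-ext : ∀ {A : Set} {k} {u v : Vec A k} → (∀ i → lookup u i ≡ lookup v i) → u ≡ v
    Vec-ext {u = u} {v} eq =
      trans (sym (tabulate∘lookup u)) (trans (tabulate-cong eq) (tabulate∘lookup v))

    ≡does : ∀ {A : Set} b (a? : Dec A) → (b ≡ true → A) → (A → b ≡ true) → b ≡ does a?
    ≡does true  (yes _) _  _    = refl
    ≡does true  (no ¬a) to _    = ⊥-elim (¬a (to refl))
    ≡does false (yes a) _  from = from a
    ≡does false (no _)  _  _    = refl

  tabulateGrid-entry : ∀ {x y} .(x<w : x < w) .(y<h : y < h) →
    lookup (lookup (tabulateGrid P? w h) (fromℕ< y<h)) (fromℕ< x<w) ≡ does (P? x y)
  tabulateGrid-entry x<w y<h = begin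
    lookup (lookup (tabulateGrid P? w h) (fromℕ< y<h)) (fromℕ< x<w)
      ≡⟨ cong (λ row → lookup row (fromℕ< x<w)) (lookup∘tabulate _ (fromℕ< y<h)) ⟩
    lookup (tabulate λ i → does (P? (toℕ i) (toℕ (fromℕ< y<h)))) (fromℕ< x<w)
      ≡⟨ lookup∘tabulate _ (fromℕ< x<w) ⟩
    does (P? (toℕ (fromℕ< x<w)) (toℕ (fromℕ< y<h)))
      ≡⟨ cong₂ (λ x y → does (P? x y)) (toℕ-fromℕ< x<w) (toℕ-fromℕ< y<h) ⟩
    does (P? _ _) ∎
    where open ≡-Reasoning

  Cell-tabulateGrid : ∀ {x y} → x < w → y < h → Cell (w , h , tabulateGrid P? w h) x y ⇔ P x y
  Cell-tabulateGrid x<w y<h = mk⇔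
    (λ (x<w′ , y<h′ , e) → does-true (P? _ _) (trans (sym (tabulateGrid-entry x<w′ y<h′)) e))
    (λ p → x<w , y<h , trans (tabulateGrid-entry x<w y<h) (dec-true (P? _ _) p))

  grid≡tabulateGrid : (G : Grid w h) → (∀ {x y} → x < w → y < h → Cell (w , h , G) x y ⇔ P x y) →
                      G ≡ tabulateGrid P? w h
  grid≡tabulateGrid G cells = Vec-ext λ j → trans (Vec-ext (entry j)) (sym (lookup∘tabulate _ j))
    where
    entry : ∀ j i → lookup (lookup G j) i ≡ lookup (tabulate λ i → does (P? (toℕ i) (toℕ j))) i
    entry j i = trans (≡does _ (P? (toℕ i) (toℕ j)) to from) (sym (lookup∘tabulate _ i))
      where
      at : ∀ {i′ j′} → i′ ≡ i → j′ ≡ j → lookup (lookup G j′) i′ ≡ lookup (lookup G j) i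
      at = cong₂ λ i′ j′ → lookup (lookup G j′) i′
      to : lookup (lookup G j) i ≡ true → P (toℕ i) (toℕ j)
      to e = Equivalence.to (cells (toℕ<n i) (toℕ<n j))
               (toℕ<n i , toℕ<n j , trans (at (fromℕ<-toℕ i _) (fromℕ<-toℕ j _)) e)
      from : P (toℕ i) (toℕ j) → lookup (lookup G j) i ≡ true
      from p with Equivalence.from (cells (toℕ<n i) (toℕ<n j)) p
      ... | _ , _ , e = trans (sym (at (fromℕ<-toℕ i _) (fromℕ<-toℕ j _))) e

Adj-sym : ∀ {p q} → Adj p q → Adj q p
Adj-sym (inj₁ (refl , inj₁ refl)) = inj₁ (refl , inj₂ refl)
Adj-sym (inj₁ (refl , inj₂ refl)) = inj₁ (refl , inj₁ refl)
Adj-sym (inj₂ (refl , inj₁ refl)) = inj₂ (refl , inj₂ refl)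
Adj-sym (inj₂ (refl , inj₂ refl)) = inj₂ (refl , inj₁ refl)

module _ {s : Shape} where

  Path-source : ∀ {x y q} → Path s (x , y) q → Cell s x y
  Path-source (here c)     = c
  Path-source (step c _ _) = c

  _++ᴾ_ : ∀ {p q r} → Path s p q → Path s q r → Path s p r
  here _       ++ᴾ π = π
  step c a π′ ++ᴾ π = step c a (π′ ++ᴾ π)

  Path-reverse : ∀ {p q} → Path s p q → Path s q p
  Path-reverse (here c)     = here c
  Path-reverse (step c a π) = Path-reverse π ++ᴾ step (Path-source π) (Adj-sym a) (here c)

  Path-crosses-row : ∀ {x y x′ y′} → Path s (x , y) (x′ , y′) →
                     ∀ {t} → y ≤ t → t < y′ → ∃ λ u → Cell s u t × Cell s u (suc t)
  Path-crosses-row (here _) y≤t t<y = ⊥-elim (<-irrefl refl (≤-<-trans y≤t t<y))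
  Path-crosses-row {x} {y} (step {q = x₁ , y₁} c a π) {t} y≤t t<y′ with y₁ ≤? t
  ... | yes y₁≤t = Path-crosses-row π y₁≤t t<y′
  ... | no  y₁≰t = climb a (Path-source π)
    where
    climb : Adj (x , y) (x₁ , y₁) → Cell s x₁ y₁ → ∃ λ u → Cell s u t × Cell s u (suc t)
    climb (inj₁ (refl , inj₁ refl)) c₁ with ≤-antisym y≤t (s≤s⁻¹ (≰⇒> y₁≰t))
    ... | refl = x , c , c₁
    climb (inj₁ (refl , inj₂ refl)) _ = ⊥-elim (y₁≰t (≤-trans (n≤1+n y₁) y≤t))
    climb (inj₂ (refl , _))         _ = ⊥-elim (y₁≰t y≤t)

module _ {s : Shape} (rows : RowConvex s)
         (meet : ∀ y → suc y < height s → ∃ λ x → Cell s x y × Cell s x (suc y)) where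

  rightward-path : ∀ {x x′ y} → x ≤ x′ → Cell s x y → Cell s x′ y → Path s (x , y) (x′ , y)
  rightward-path x≤x′ c c′ with m≤n⇒m<n∨m≡n x≤x′
  ... | inj₂ refl = here c
  rightward-path {x} {suc x″} {y} _ c c′ | inj₁ (s≤s x≤x″) =
    rightward-path x≤x″ c c″ ++ᴾ step c″ (inj₂ (refl , inj₁ refl)) (here c′)
    where c″ = rows y x x″ (suc x″) c c′ x≤x″ (n≤1+n x″)

  row-path : ∀ {x x′ y} → Cell s x y → Cell s x′ y → Path s (x , y) (x′ , y)
  row-path {x} {x′} c c′ with ≤-total x x′
  ... | inj₁ x≤x′ = rightward-path x≤x′ c c′
  ... | inj₂ x′≤x = Path-reverse (rightward-path x′≤x c′ c)

  upward-path : ∀ {x x′ y y′} → y ≤ y′ → Cell s x y → Cell s x′ y′ → Path s (x , y) (x′ , y′)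
  upward-path y≤y′ c c′ with m≤n⇒m<n∨m≡n y≤y′
  ... | inj₂ refl = row-path c c′
  upward-path {x} {x′} {y} {suc y″} _ c c′ | inj₁ (s≤s y≤y″) with meet y″ (Cell⇒<height {s} c′)
  ... | u , d , d′ = upward-path y≤y″ c d ++ᴾ step d (inj₁ (refl , inj₁ refl)) (row-path d′ c′)

  rows-meet⇒EdgeConnected : EdgeConnected s
  rows-meet⇒EdgeConnected x y x′ y′ c c′ with ≤-total y y′
  ... | inj₁ y≤y′ = upward-path y≤y′ c c′
  ... | inj₂ y′≤y = Path-reverse (upward-path y′≤y c′ c)

-- Staircases and the regions they cut out

module _ (n : ℕ) where

  -- The last component is the image of the third, kept as n ∸ (n ∸ x) rather than x so
  -- that it needs no x ≤ n.
  AllRotations : (ℕ → ℕ → Set) → ℕ → ℕ → Set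
  AllRotations P x y = P x y × P y (n ∸ x) × P (n ∸ x) (n ∸ y) × P (n ∸ y) (n ∸ (n ∸ x))

  module _ {P : ℕ → ℕ → Set} {x y : ℕ} (x≤n : x ≤ n) (y≤n : y ≤ n) where

    AllRotations-rotate : AllRotations P x y → AllRotations P y (n ∸ x)
    AllRotations-rotate (p₀ , p₁ , p₂ , p₃) =
      p₁ , p₂ , p₃ , subst₂ P (sym (m∸[m∸n]≡n x≤n)) (sym (m∸[m∸n]≡n y≤n)) p₀

    AllRotations-rotate⁻¹ : AllRotations P y (n ∸ x) → AllRotations P x y
    AllRotations-rotate⁻¹ (p₁ , p₂ , p₃ , p₄) =
      subst₂ P (m∸[m∸n]≡n x≤n) (m∸[m∸n]≡n y≤n) p₄ , p₁ , p₂ , p₃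

  allRotations? : ∀ {P : ℕ → ℕ → Set} → (∀ x y → Dec (P x y)) → ∀ x y → Dec (AllRotations P x y)
  allRotations? P? x y =
    P? x y ×-dec P? y (n ∸ x) ×-dec P? (n ∸ x) (n ∸ y) ×-dec P? (n ∸ y) (n ∸ (n ∸ x))

  AllRotations-map : ∀ {P Q : ℕ → ℕ → Set} → (∀ {x y} → P x y → Q x y) →
                     ∀ {x y} → AllRotations P x y → AllRotations Q x y
  AllRotations-map f (p₀ , p₁ , p₂ , p₃) = f p₀ , f p₁ , f p₂ , f p₃

record Staircase (n : ℕ) : Set where
  field
    indent    : ℕ → ℕ
    antitone  : ∀ y → indent (suc y) ≤ indent y
    -- the cell (indent 0 , 0) rotates to (0 , n ∸ indent 0)
    vanishing : ∀ y → n ≤ indent 0 + y → indent y ≡ 0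

open Staircase using (indent)

module _ {n : ℕ} (σ : Staircase n) where
  open Staircase σ renaming (indent to g)

  indent-antitone : ∀ {y y′} → y ≤ y′ → g y′ ≤ g y
  indent-antitone y≤y′ with m≤n⇒m<n∨m≡n y≤y′
  ... | inj₂ refl = ≤-refl
  indent-antitone {y} {suc y″} _ | inj₁ (s≤s y≤y″) = ≤-trans (antitone y″) (indent-antitone y≤y″)

  indent≤indent₀ : ∀ y → g y ≤ g 0
  indent≤indent₀ y = indent-antitone z≤n

  indent₀≤n : g 0 ≤ n
  indent₀≤n with n ≤? g 0 + 0
  ... | yes n≤g₀ = subst (_≤ n) (sym (vanishing 0 n≤g₀)) z≤n
  ... | no  n≰g₀ = ≤-trans (m≤m+n (g 0) 0) (<⇒≤ (≰⇒> n≰g₀))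

  indent≤n∸indent₀ : ∀ {t} → g 0 ≤ t → g t ≤ n ∸ g 0
  indent≤n∸indent₀ {t} g₀≤t with n ≤? g 0 + t
  ... | yes n≤g₀+t rewrite vanishing t n≤g₀+t = z≤n
  ... | no  n≰g₀+t = ≤-trans (≤-trans (indent≤indent₀ t) g₀≤t)
                       (m+n≤o⇒m≤o∸n t (subst (_≤ n) (+-comm (g 0) t) (<⇒≤ (≰⇒> n≰g₀+t))))

  Uncut : ℕ → ℕ → Set
  Uncut x y = g y ≤ x

  InRegion : ℕ → ℕ → Set
  InRegion = AllRotations n Uncut

  inRegion? : ∀ x y → Dec (InRegion x y)
  inRegion? = allRotations? n (λ x y → g y ≤? x)

  region-row-interval : ∀ y → IsInterval (λ x → InRegion x y)
  region-row-interval y x₁ x x₂ (a₀ , _ , _ , a₃) (_ , b₁ , b₂ , _) x₁≤x x≤x₂ =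
    ≤-trans a₀ x₁≤x ,
    ≤-trans (indent-antitone (∸-monoʳ-≤ n x≤x₂)) b₁ ,
    ≤-trans b₂ (∸-monoʳ-≤ n x≤x₂) ,
    ≤-trans (indent-antitone (∸-monoʳ-≤ n (∸-monoʳ-≤ n x₁≤x))) a₃

  region-column-interval : ∀ x → IsInterval (InRegion x)
  region-column-interval x y₁ y y₂ (a₀ , a₁ , _ , _) (_ , _ , b₂ , b₃) y₁≤y y≤y₂ =
    ≤-trans (indent-antitone y₁≤y) a₀ ,
    ≤-trans a₁ y₁≤y ,
    ≤-trans (indent-antitone (∸-monoʳ-≤ n y≤y₂)) b₂ ,
    ≤-trans b₃ (∸-monoʳ-≤ n y≤y₂)

  region-rotate : ∀ {x y} → x ≤ n → y ≤ n → InRegion x y → InRegion y (n ∸ x)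
  region-rotate = AllRotations-rotate n {Uncut}

  region-rotate⁻¹ : ∀ {x y} → x ≤ n → y ≤ n → InRegion y (n ∸ x) → InRegion x y
  region-rotate⁻¹ = AllRotations-rotate⁻¹ n {Uncut}

  region-half-turn : ∀ {x y} → x ≤ n → y ≤ n → InRegion x y → InRegion (n ∸ x) (n ∸ y)
  region-half-turn {x} x≤n y≤n = region-rotate y≤n (m∸n≤m n x) ∘ region-rotate x≤n y≤n

  indent-in-region : ∀ {y y′} → y ≤ y′ → g 0 + y′ ≤ n → InRegion (g y) y′
  indent-in-region {y} {y′} y≤y′ g₀+y′≤n =
    indent-antitone y≤y′ ,
    subst (_≤ y′) (sym (vanishing (n ∸ g y) n≤g₀+[n∸gy])) z≤n ,
    ≤-trans (indent≤n∸indent₀ g₀≤n∸y′) (∸-monoʳ-≤ n (indent≤indent₀ y)) ,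
    ≤-trans (indent≤indent₀ _) g₀≤n∸y′
    where
    g₀≤n∸y′ : g 0 ≤ n ∸ y′
    g₀≤n∸y′ = m+n≤o⇒m≤o∸n (g 0) g₀+y′≤n
    n≤g₀+[n∸gy] : n ≤ g 0 + (n ∸ g y)
    n≤g₀+[n∸gy] = ≤-trans (m≤n+m∸n n (g y)) (+-monoˡ-≤ (n ∸ g y) (indent≤indent₀ y))

  far-column-in-region : n ≤ g 0 + g 0 → ∀ {t} → n ≤ g 0 + t → InRegion (n ∸ g 0) t
  far-column-in-region n≤2g₀ {t} n≤g₀+t =
    subst (_≤ n ∸ g 0) (sym (vanishing t n≤g₀+t)) z≤n ,
    subst (_≤ t) (sym (trans (cong g n∸[n∸g₀]≡g₀) (vanishing (g 0) n≤2g₀))) z≤n ,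
    subst (g (n ∸ t) ≤_) (sym n∸[n∸g₀]≡g₀) (indent≤indent₀ (n ∸ t)) ,
    subst (_≤ n ∸ t) (sym g[n∸g₀]≡0) z≤n
    where
    n∸[n∸g₀]≡g₀ : n ∸ (n ∸ g 0) ≡ g 0
    n∸[n∸g₀]≡g₀ = m∸[m∸n]≡n indent₀≤n
    g[n∸g₀]≡0 : g (n ∸ (n ∸ (n ∸ g 0))) ≡ 0
    g[n∸g₀]≡0 = trans (cong (λ v → g (n ∸ v)) n∸[n∸g₀]≡g₀)
                      (vanishing (n ∸ g 0) (≤-reflexive (sym (m+[n∸m]≡n indent₀≤n))))

  lower-rows-meet : ∀ {y} → g 0 + suc y ≤ n → InRegion (g y) y × InRegion (g y) (suc y)
  lower-rows-meet {y} g₀+1+y≤n =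
    indent-in-region ≤-refl (≤-trans (+-monoʳ-≤ (g 0) (n≤1+n y)) g₀+1+y≤n) ,
    indent-in-region (n≤1+n y) g₀+1+y≤n

  upper-rows-meet : ∀ {y} → g 0 ≤ y → suc y ≤ n →
                    ∃ λ x → x ≤ n × InRegion x y × InRegion x (suc y)
  upper-rows-meet {y} g₀≤y 1+y≤n =
    n ∸ g y′ , m∸n≤m n (g y′) ,
    subst (InRegion (n ∸ g y′)) n∸[1+y′]≡y (region-half-turn gy′≤n 1+y′≤n r₁) ,
    subst (InRegion (n ∸ g y′)) (m∸[m∸n]≡n 1+y≤n) (region-half-turn gy′≤n (m∸n≤m n (suc y)) r₀)
    where
    y′ = n ∸ suc y
    1+y′≡n∸y : suc y′ ≡ n ∸ y
    1+y′≡n∸y = sym (+-∸-assoc 1 1+y≤n)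
    1+y′≤n : suc y′ ≤ n
    1+y′≤n = subst (_≤ n) (sym 1+y′≡n∸y) (m∸n≤m n y)
    n∸[1+y′]≡y : n ∸ suc y′ ≡ y
    n∸[1+y′]≡y = trans (cong (n ∸_) 1+y′≡n∸y) (m∸[m∸n]≡n (<⇒≤ 1+y≤n))
    gy′≤n : g y′ ≤ n
    gy′≤n = ≤-trans (indent≤indent₀ y′) indent₀≤n
    g₀+1+y′≤n : g 0 + suc y′ ≤ n
    g₀+1+y′≤n = subst (λ v → g 0 + v ≤ n) (sym 1+y′≡n∸y)
                  (≤-trans (+-monoˡ-≤ (n ∸ y) g₀≤y) (≤-reflexive (m+[n∸m]≡n (<⇒≤ 1+y≤n))))
    r₀ = proj₁ (lower-rows-meet g₀+1+y′≤n)
    r₁ = proj₂ (lower-rows-meet g₀+1+y′≤n)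

  region-rows-meet : ∀ y → suc y ≤ n → ∃ λ x → x ≤ n × InRegion x y × InRegion x (suc y)
  region-rows-meet y 1+y≤n with g 0 + suc y ≤? n | g 0 ≤? y
  ... | yes lower | _        = g y , ≤-trans (indent≤indent₀ y) indent₀≤n , lower-rows-meet lower
  ... | no  _     | yes g₀≤y = upper-rows-meet g₀≤y 1+y≤n
  ... | no  upper | no  g₀≰y =
    n ∸ g 0 , m∸n≤m n (g 0) ,
    far-column-in-region n≤2g₀ n≤g₀+y ,
    far-column-in-region n≤2g₀ (≤-trans n≤g₀+y (+-monoʳ-≤ (g 0) (n≤1+n y)))
    where
    n≤g₀+y : n ≤ g 0 + y
    n≤g₀+y = s≤s⁻¹ (subst (n <_) (+-suc (g 0) y) (≰⇒> upper))
    n≤2g₀ : n ≤ g 0 + g 0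
    n≤2g₀ = ≤-trans n≤g₀+y (+-monoʳ-≤ (g 0) (<⇒≤ (≰⇒> g₀≰y)))

  indent-attained : ∀ y → ∃ λ y′ → y′ ≤ y × InRegion (g y) y′
  indent-attained y with g 0 + y ≤? n
  ... | yes g₀+y≤n = y , ≤-refl , indent-in-region ≤-refl g₀+y≤n
  ... | no  g₀+y≰n =
    n ∸ g 0 , m≤n+o⇒m∸n≤o n (g 0) n≤g₀+y ,
    subst (λ x → InRegion x (n ∸ g 0)) g[n∸g₀]≡gy
      (indent-in-region ≤-refl (≤-reflexive (m+[n∸m]≡n indent₀≤n)))
    where
    n≤g₀+y : n ≤ g 0 + y
    n≤g₀+y = <⇒≤ (≰⇒> g₀+y≰n)
    g[n∸g₀]≡gy : g (n ∸ g 0) ≡ g y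
    g[n∸g₀]≡gy = trans (vanishing (n ∸ g 0) (≤-reflexive (sym (m+[n∸m]≡n indent₀≤n))))
                       (sym (vanishing y n≤g₀+y))

regionShape : ∀ {n} → Staircase n → Shape
regionShape {n} σ = suc n , suc n , tabulateGrid (inRegion? σ) (suc n) (suc n)

module _ {n : ℕ} (σ : Staircase n) where

  Cell-regionShape : ∀ {x y} → Cell (regionShape σ) x y ⇔ (x ≤ n × y ≤ n × InRegion σ x y)
  Cell-regionShape = mk⇔
    (λ c@(x<1+n , y<1+n , _) → s≤s⁻¹ x<1+n , s≤s⁻¹ y<1+n ,
                               Equivalence.to (Cell-tabulateGrid (inRegion? σ) x<1+n y<1+n) c)
    (λ (x≤n , y≤n , r) → Equivalence.from (Cell-tabulateGrid (inRegion? σ) (s≤s x≤n) (s≤s y≤n)) r)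

  private
    cell : ∀ {x y} → x ≤ n → y ≤ n → InRegion σ x y → Cell (regionShape σ) x y
    cell x≤n y≤n r = Equivalence.from Cell-regionShape (x≤n , y≤n , r)

    region : ∀ {x y} → Cell (regionShape σ) x y → x ≤ n × y ≤ n × InRegion σ x y
    region = Equivalence.to Cell-regionShape

  regionShape-tight : Tight (regionShape σ)
  regionShape-tight =
    (g₀ , cell (indent₀≤n σ) z≤n corner) ,
    (n ∸ g₀ , cell (m∸n≤m n g₀) ≤-refl corner₂) ,
    (n ∸ g₀ , cell z≤n (m∸n≤m n g₀) corner₁) ,
    (n ∸ (n ∸ g₀) , cell ≤-refl (m∸n≤m n (n ∸ g₀)) corner₃)
    where
    g₀ = indent σ 0
    corner = indent-in-region σ z≤n (subst (_≤ n) (sym (+-identityʳ g₀)) (indent₀≤n σ))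
    corner₁ = region-rotate σ (indent₀≤n σ) z≤n corner
    corner₂ = region-rotate σ z≤n (m∸n≤m n g₀) corner₁
    corner₃ = region-rotate σ (m∸n≤m n g₀) ≤-refl corner₂

  regionShape-convex : Convex (regionShape σ)
  regionShape-convex = rows , columns
    where
    rows : RowConvex (regionShape σ)
    rows y x₁ x x₂ c₁ c₂ x₁≤x x≤x₂ with region c₁ | region c₂
    ... | _ , y≤n , r₁ | x₂≤n , _ , r₂ =
      cell (≤-trans x≤x₂ x₂≤n) y≤n (region-row-interval σ y x₁ x x₂ r₁ r₂ x₁≤x x≤x₂)
    columns : ColumnConvex (regionShape σ)
    columns x y₁ y y₂ c₁ c₂ y₁≤y y≤y₂ with region c₁ | region c₂
    ... | x≤n , _ , r₁ | _ , y₂≤n , r₂ =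
      cell x≤n (≤-trans y≤y₂ y₂≤n) (region-column-interval σ x y₁ y y₂ r₁ r₂ y₁≤y y≤y₂)

  regionShape-connected : EdgeConnected (regionShape σ)
  regionShape-connected = rows-meet⇒EdgeConnected (proj₁ regionShape-convex) meet
    where
    meet : ∀ y → suc y < suc n → ∃ λ x → Cell (regionShape σ) x y × Cell (regionShape σ) x (suc y)
    meet y (s≤s 1+y≤n) with region-rows-meet σ y 1+y≤n
    ... | x , x≤n , r , r′ = x , cell x≤n (<⇒≤ 1+y≤n) r , cell x≤n 1+y≤n r′

  regionShape-rotInvariant : RotInvariant90 (regionShape σ)
  regionShape-rotInvariant = refl , λ x y x<1+n y<1+n →
    let x≤n = s≤s⁻¹ x<1+n ; y≤n = s≤s⁻¹ y<1+n in mk⇔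
    (λ c → cell y≤n (m∸n≤m n x) (region-rotate σ x≤n y≤n (proj₂ (proj₂ (region c)))))
    (λ c → cell x≤n y≤n (region-rotate⁻¹ σ x≤n y≤n (proj₂ (proj₂ (region c)))))

  regionShape-valid : ConvexRotInv (2 * suc n) (regionShape σ)
  regionShape-valid =
    cong (suc n +_) (sym (+-identityʳ (suc n))) ,
    (regionShape-tight , regionShape-connected) ,
    regionShape-convex ,
    regionShape-rotInvariant

-- Every valid shape is a staircase region

module Classification {n : ℕ} {s : Shape}
  (bounded  : ∀ {x y} → Cell s x y → x ≤ n × y ≤ n)
  (convex   : Convex s)
  (rotation : ∀ {x y} → x ≤ n → y ≤ n → Cell s x y ⇔ Cell s y (n ∸ x))
  (meet     : ∀ y → suc y ≤ n → ∃ λ x → Cell s x y × Cell s x (suc y))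
  (bottom   : ∃ λ x → Cell s x 0)
  where

  LeftEmpty RightEmpty BelowEmpty AboveEmpty : ℕ → ℕ → Set
  LeftEmpty  x y = ∀ {x′} → x′ ≤ x → ¬ Cell s x′ y
  RightEmpty x y = ∀ {x′} → x ≤ x′ → ¬ Cell s x′ y
  BelowEmpty x y = ∀ {y′} → y′ ≤ y → ¬ Cell s x y′
  AboveEmpty x y = ∀ {y′} → y ≤ y′ → ¬ Cell s x y′

  row-gap : ∀ {x y} → ¬ Cell s x y → LeftEmpty x y ⊎ RightEmpty x y
  row-gap {y = y} = interval-gap (λ x → cell? s x y) (proj₁ convex y)

  column-gap : ∀ {x y} → ¬ Cell s x y → BelowEmpty x y ⊎ AboveEmpty x y
  column-gap {x} = interval-gap (cell? s x) (proj₂ convex x)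

  rotate-cell : ∀ {x y} → Cell s x y → Cell s y (n ∸ x)
  rotate-cell c = Equivalence.to (rotation (proj₁ (bounded c)) (proj₂ (bounded c))) c

  unrotate-cell : ∀ {x y} → x ≤ n → Cell s y (n ∸ x) → Cell s x y
  unrotate-cell x≤n c = Equivalence.from (rotation x≤n (proj₁ (bounded c))) c

  unrotate-cell′ : ∀ {y v} → Cell s y v → Cell s (n ∸ v) y
  unrotate-cell′ {y} {v} c = unrotate-cell (m∸n≤m n v)
    (subst (Cell s y) (sym (m∸[m∸n]≡n (proj₂ (bounded c)))) c)

  below⇒left : ∀ {x y} → x ≤ n → BelowEmpty x y → LeftEmpty y (n ∸ x)
  below⇒left x≤n below u≤y c = below u≤y (unrotate-cell x≤n c)

  above⇒right : ∀ {x y} → x ≤ n → AboveEmpty x y → RightEmpty y (n ∸ x)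
  above⇒right x≤n above y≤u c = above y≤u (unrotate-cell x≤n c)

  right⇒below : ∀ {x y} → x ≤ n → RightEmpty x y → BelowEmpty y (n ∸ x)
  right⇒below x≤n right {v} v≤n∸x c =
    right (subst (_≤ n ∸ v) (m∸[m∸n]≡n x≤n) (∸-monoʳ-≤ n v≤n∸x)) (unrotate-cell′ c)

  left⇒above : ∀ {x y} → x ≤ n → LeftEmpty x y → AboveEmpty y (n ∸ x)
  left⇒above x≤n left {v} n∸x≤v c =
    left (subst (n ∸ v ≤_) (m∸[m∸n]≡n x≤n) (∸-monoʳ-≤ n n∸x≤v)) (unrotate-cell′ c)

  quadrant-empty : ∀ {x y} → y ≤ n → LeftEmpty x y → BelowEmpty x y →
                   ∀ {y′} → y′ ≤ y → LeftEmpty x y′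
  quadrant-empty {x} {y} y≤n left below {y′} y′≤y = descend (y ∸ y′) (m+[n∸m]≡n y′≤y)
    where
    -- Rows y′ and y′ + 1 meet in some column u: if u ≤ x the cell moves up a row, and
    -- otherwise row convexity puts a cell in column x below y.
    descend : ∀ k {y′} → y′ + k ≡ y → LeftEmpty x y′
    descend zero    {y′} y′+0≡y = subst (LeftEmpty x) (trans (sym y′+0≡y) (+-identityʳ y′)) left
    descend (suc k) {y′} y′+1+k≡y {x′} x′≤x c with meet y′ (≤-trans 1+y′≤y y≤n)
      where
      1+y′+k≡y = trans (sym (+-suc y′ k)) y′+1+k≡y
      1+y′≤y = subst (suc y′ ≤_) 1+y′+k≡y (s≤s (m≤m+n y′ k))
    ... | u , d , d′ with u ≤? x
    ...   | yes u≤x = descend k (trans (sym (+-suc y′ k)) y′+1+k≡y) u≤x d′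
    ...   | no  u≰x = below (subst (y′ ≤_) y′+1+k≡y (m≤m+n y′ (suc k)))
                            (proj₁ convex y′ x′ x u c d x′≤x (<⇒≤ (≰⇒> u≰x)))

  leftmost : ℕ → ℕ
  leftmost y = least (λ x → cell? s x y) (suc n)

  corner : ℕ → ℕ
  corner zero    = leftmost zero
  corner (suc y) = corner y ⊓ leftmost (suc y)

  corner-≤ : ∀ {x y y′} → Cell s x y′ → y′ ≤ y → corner y ≤ x
  corner-≤ {y = zero} c z≤n = least-≤ (λ x → cell? s x 0) (suc n) c
  corner-≤ {y = suc y} c y′≤1+y with m≤n⇒m<n∨m≡n y′≤1+y
  ... | inj₁ y′<1+y = ≤-trans (m⊓n≤m _ _) (corner-≤ c (s≤s⁻¹ y′<1+y))
  ... | inj₂ refl   = ≤-trans (m⊓n≤n _ _) (least-≤ _ (suc n) c)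

  <-corner : ∀ {x y} → x ≤ n → (∀ {y′} → y′ ≤ y → LeftEmpty x y′) → x < corner y
  <-corner {y = zero}  x≤n empty = <-least _ (s≤s x≤n) (empty z≤n)
  <-corner {y = suc y} x≤n empty =
    ⊓-glb (<-corner x≤n (empty ∘ m≤n⇒m≤1+n)) (<-least _ (s≤s x≤n) (empty ≤-refl))

  corner-gap : ∀ {x y} → x ≤ n → y ≤ n → LeftEmpty x y → BelowEmpty x y → x < corner y
  corner-gap x≤n y≤n left below = <-corner x≤n (quadrant-empty y≤n left below)

  cornerStaircase : Staircase n
  cornerStaircase = record { indent = corner ; antitone = λ y → m⊓n≤m _ _ ; vanishing = vanishing }
    where
    bottom-corner : Cell s (corner 0) 0
    bottom-corner = least-witness (λ x → cell? s x 0) (suc n)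
      (s≤s (≤-trans (corner-≤ {y = 0} (proj₂ bottom) z≤n) (proj₁ (bounded (proj₂ bottom)))))
    vanishing : ∀ y → n ≤ corner 0 + y → corner y ≡ 0
    vanishing y n≤c₀+y =
      n≤0⇒n≡0 (corner-≤ (rotate-cell bottom-corner) (m≤n+o⇒m∸n≤o n (corner 0) n≤c₀+y))

  cell⇒region : ∀ {x y} → Cell s x y → InRegion cornerStaircase x y
  cell⇒region c = AllRotations-map n {Cell s} {Uncut cornerStaircase} (λ c′ → corner-≤ c′ ≤-refl)
                                   (c , c₁ , c₂ , rotate-cell c₂)
    where
    c₁ = rotate-cell c
    c₂ = rotate-cell c₁

  -- A missing cell leaves an empty half-row and an empty half-column; rotating the point until
  -- they point left and down empties a south-west quadrant, contradicting a component.
  region⇒cell : ∀ {x y} → x ≤ n → y ≤ n → InRegion cornerStaircase x y → Cell s x y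
  region⇒cell {x} {y} x≤n y≤n (u₀ , u₁ , u₂ , u₃) with cell? s x y
  ... | yes c = c
  ... | no ¬c with row-gap ¬c | column-gap ¬c
  ... | inj₁ L | inj₁ B = ⊥-elim (<⇒≱ (corner-gap x≤n y≤n L B) u₀)
  ... | inj₂ R | inj₁ B = ⊥-elim (<⇒≱ (corner-gap y≤n (m∸n≤m n x)
                            (below⇒left x≤n B) (right⇒below x≤n R)) u₁)
  ... | inj₂ R | inj₂ A = ⊥-elim (<⇒≱ (corner-gap (m∸n≤m n x) (m∸n≤m n y)
                            (below⇒left y≤n (right⇒below x≤n R))
                            (right⇒below y≤n (above⇒right x≤n A))) u₂)
  ... | inj₁ L | inj₂ A = ⊥-elim (<⇒≱ (corner-gap (m∸n≤m n y) (m∸n≤m n (n ∸ x))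
                            (below⇒left (m∸n≤m n x) (right⇒below y≤n (above⇒right x≤n A)))
                            (right⇒below (m∸n≤m n x) (above⇒right y≤n (left⇒above x≤n L)))) u₃)

half-injective : ∀ {m k} → m + m ≡ 2 * k → m ≡ k
half-injective {m} {k} m+m≡2k = *-cancelˡ-≡ m k 2 (trans (cong (m +_) (+-identityʳ m)) m+m≡2k)

ConvexRotInv⇒regionShape : ∀ n s → ConvexRotInv (2 * suc n) s →
                           ∃ λ (σ : Staircase n) → s ≡ regionShape σ
ConvexRotInv⇒regionShape n (w , .w , G)
  (perimeter , (((x₀ , c₀) , (x₁ , c₁) , _) , connected) , convex , refl , rotation)
  with half-injective {w} {suc n} perimeter
... | refl = cornerStaircase ,
             cong (λ G′ → suc n , suc n , G′) (grid≡tabulateGrid (inRegion? cornerStaircase) G cells)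
  where
  s = suc n , suc n , G
  bounded : ∀ {x y} → Cell s x y → x ≤ n × y ≤ n
  bounded (x<1+n , y<1+n , _) = s≤s⁻¹ x<1+n , s≤s⁻¹ y<1+n
  meet : ∀ y → suc y ≤ n → ∃ λ x → Cell s x y × Cell s x (suc y)
  meet y 1+y≤n = Path-crosses-row (connected x₀ 0 x₁ n c₀ c₁) z≤n 1+y≤n
  open Classification {s = s} bounded convex
         (λ x≤n y≤n → rotation _ _ (s≤s x≤n) (s≤s y≤n)) meet (x₀ , c₀)
  cells : ∀ {x y} → x < suc n → y < suc n → Cell s x y ⇔ InRegion cornerStaircase x y
  cells x<1+n y<1+n = mk⇔ cell⇒region (region⇒cell (s≤s⁻¹ x<1+n) (s≤s⁻¹ y<1+n))

indent-≤-of-region⊆ : ∀ {n} (σ τ : Staircase n) →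
  (∀ {x y} → x ≤ n → y ≤ n → InRegion σ x y → InRegion τ x y) → ∀ y → indent τ y ≤ indent σ y
indent-≤-of-region⊆ {n} σ τ σ⊆τ y with y ≤? n
... | no  y≰n = subst (_≤ indent σ y) (sym (Staircase.vanishing τ y n≤τ₀+y)) z≤n
  where n≤τ₀+y = ≤-trans (<⇒≤ (≰⇒> y≰n)) (m≤n+m y (indent τ 0))
... | yes y≤n with indent-attained σ y
...   | y′ , y′≤y , r =
  ≤-trans (indent-antitone τ y′≤y)
          (proj₁ (σ⊆τ (≤-trans (indent≤indent₀ σ y) (indent₀≤n σ)) (≤-trans y′≤y y≤n) r))

region-cong : ∀ {n} (σ τ : Staircase n) → indent σ ≗ indent τ →
              ∀ {x y} → InRegion σ x y → InRegion τ x y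
region-cong {n} σ τ σ≗τ = AllRotations-map n {Uncut σ} {Uncut τ} (λ {x} {y} → subst (_≤ x) (σ≗τ y))

module _ {n : ℕ} {σ τ : Staircase n} where

  regionShape-cong : indent σ ≗ indent τ → regionShape σ ≡ regionShape τ
  regionShape-cong σ≗τ = cong (λ G → suc n , suc n , G)
    (grid≡tabulateGrid (inRegion? τ) _ λ x<1+n y<1+n → mk⇔
      (region-cong σ τ σ≗τ ∘ Equivalence.to (Cell-tabulateGrid (inRegion? σ) x<1+n y<1+n))
      (Equivalence.from (Cell-tabulateGrid (inRegion? σ) x<1+n y<1+n) ∘ region-cong τ σ (sym ∘ σ≗τ)))

  region⊆-of-regionShape≡ : regionShape σ ≡ regionShape τ →
                            ∀ {x y} → x ≤ n → y ≤ n → InRegion σ x y → InRegion τ x y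
  region⊆-of-regionShape≡ eq {x} {y} x≤n y≤n r =
    proj₂ (proj₂ (Equivalence.to (Cell-regionShape τ)
      (subst (λ s → Cell s x y) eq (Equivalence.from (Cell-regionShape σ) (x≤n , y≤n , r)))))

regionShape-injective : ∀ {n} {σ τ : Staircase n} →
                        regionShape σ ≡ regionShape τ → indent σ ≗ indent τ
regionShape-injective {σ = σ} {τ} eq y = ≤-antisym
  (indent-≤-of-region⊆ τ σ (region⊆-of-regionShape≡ {σ = τ} {σ} (sym eq)) y)
  (indent-≤-of-region⊆ σ τ (region⊆-of-regionShape≡ {σ = σ} {τ} eq) y)

-- Counting staircases

flat : ∀ {n} → Staircase n
flat = record { indent = λ _ → 0 ; antitone = λ _ → z≤n ; vanishing = λ _ _ → refl }

flat-unique : ∀ {n} (σ : Staircase n) → n ≤ 1 → ∀ y → indent σ y ≡ 0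
flat-unique {n} σ n≤1 y = n≤0⇒n≡0 (≤-trans (indent≤indent₀ σ y) g₀≤0)
  where
  open Staircase σ renaming (indent to g)
  g₀≤0 : g 0 ≤ 0
  g₀≤0 with n ≤? g 0 + 0
  ... | yes n≤g₀ = ≤-reflexive (vanishing 0 n≤g₀)
  ... | no  n≰g₀ = ≤-trans (m≤m+n (g 0) 0) (s≤s⁻¹ (≤-trans (≰⇒> n≰g₀) n≤1))

repeatHead : ∀ {n} → Staircase n → Staircase (suc n)
repeatHead {n} σ = record { indent = g′ ; antitone = antitone′ ; vanishing = vanishing′ }
  where
  open Staircase σ renaming (indent to g)
  g′ : ℕ → ℕ
  g′ zero    = g 0
  g′ (suc y) = g y
  antitone′ : ∀ y → g′ (suc y) ≤ g′ y
  antitone′ zero    = ≤-refl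
  antitone′ (suc y) = antitone y
  vanishing′ : ∀ y → suc n ≤ g 0 + y → g′ y ≡ 0
  vanishing′ zero    1+n≤g₀+0 = vanishing 0 (≤-trans (n≤1+n n) 1+n≤g₀+0)
  vanishing′ (suc y) 1+n≤g₀+1+y = vanishing y (s≤s⁻¹ (subst (suc n ≤_) (+-suc (g 0) y) 1+n≤g₀+1+y))

dropHead : ∀ {n} → Staircase (suc n) → Staircase n
dropHead {n} σ = record { indent = g ∘ suc ; antitone = antitone ∘ suc ; vanishing = vanishing′ }
  where
  open Staircase σ renaming (indent to g)
  vanishing′ : ∀ y → n ≤ g 1 + y → g (suc y) ≡ 0
  vanishing′ y n≤g₁+y = vanishing (suc y)
    (subst (suc n ≤_) (sym (+-suc (g 0) y)) (s≤s (≤-trans n≤g₁+y (+-monoˡ-≤ y (antitone 0)))))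

sucHead : ∀ {n} → Staircase (suc n) → Staircase (suc (suc n))
sucHead {n} σ = record { indent = g′ ; antitone = antitone′ ; vanishing = vanishing′ }
  where
  open Staircase σ renaming (indent to g)
  g′ : ℕ → ℕ
  g′ zero    = suc (g 0)
  g′ (suc y) = g (suc y)
  antitone′ : ∀ y → g′ (suc y) ≤ g′ y
  antitone′ zero    = m≤n⇒m≤1+n (antitone 0)
  antitone′ (suc y) = antitone (suc y)
  vanishing′ : ∀ y → suc (suc n) ≤ suc (g 0) + y → g′ y ≡ 0
  vanishing′ zero (s≤s 1+n≤g₀+0) =
    ⊥-elim (n≮0 (subst (λ v → suc n ≤ v + 0) (vanishing 0 1+n≤g₀+0) 1+n≤g₀+0))
  vanishing′ (suc y) (s≤s 1+n≤g₀+1+y) = vanishing (suc y) 1+n≤g₀+1+y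

predHead : ∀ {n} (σ : Staircase (suc (suc n))) {k} →
           indent σ 0 ≡ suc k → indent σ 1 ≤ k → Staircase (suc n)
predHead {n} σ {k} g₀≡1+k g₁≤k =
  record { indent = g′ ; antitone = antitone′ ; vanishing = vanishing′ }
  where
  open Staircase σ renaming (indent to g)
  g′ : ℕ → ℕ
  g′ zero    = k
  g′ (suc y) = g (suc y)
  antitone′ : ∀ y → g′ (suc y) ≤ g′ y
  antitone′ zero    = g₁≤k
  antitone′ (suc y) = antitone (suc y)
  lift : ∀ {y} → suc n ≤ k + y → suc (suc n) ≤ g 0 + y
  lift {y} 1+n≤k+y = subst (λ v → suc (suc n) ≤ v + y) (sym g₀≡1+k) (s≤s 1+n≤k+y)
  vanishing′ : ∀ y → suc n ≤ k + y → g′ y ≡ 0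
  vanishing′ zero    1+n≤k+0 = ⊥-elim (1+n≢0 (trans (sym g₀≡1+k) (vanishing 0 (lift 1+n≤k+0))))
  vanishing′ (suc y) 1+n≤k+1+y = vanishing (suc y) (lift 1+n≤k+1+y)

double : ∀ {n} → List (Staircase (suc n)) → List (Staircase (suc (suc n)))
double L = map repeatHead L ++ map sucHead L

length-double : ∀ {n} (L : List (Staircase (suc n))) → length (double L) ≡ 2 * length L
length-double L = begin
  length (map repeatHead L ++ map sucHead L)
    ≡⟨ length-++ (map repeatHead L) ⟩
  length (map repeatHead L) + length (map sucHead L)
    ≡⟨ cong₂ _+_ (length-map repeatHead L) (length-map sucHead L) ⟩
  length L + length L
    ≡⟨ cong (length L +_) (sym (+-identityʳ (length L))) ⟩
  2 * length L ∎
  where open ≡-Reasoning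

double-complete : ∀ {n} {L : List (Staircase (suc n))} →
  (∀ τ → Any (λ ρ → indent ρ ≗ indent τ) L) → ∀ σ → Any (λ ρ → indent ρ ≗ indent σ) (double L)
double-complete {n} {L} complete σ with m≤n⇒m<n∨m≡n (Staircase.antitone σ 0)
... | inj₂ g₁≡g₀ = Anyₚ.++⁺ˡ (Anyₚ.map⁺ (Any.map repeatHead-dropHead (complete (dropHead σ))))
  where
  repeatHead-dropHead : ∀ {τ} → indent τ ≗ indent (dropHead σ) → indent (repeatHead τ) ≗ indent σ
  repeatHead-dropHead τ≗ zero    = trans (τ≗ 0) g₁≡g₀
  repeatHead-dropHead τ≗ (suc y) = τ≗ y
... | inj₁ g₁<g₀ with indent σ 0 in g₀≡
...   | suc k = Anyₚ.++⁺ʳ (map repeatHead L) (Anyₚ.map⁺ (Any.map sucHead-predHead (complete σ′)))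
  where
  σ′ : Staircase (suc n)
  σ′ = predHead σ g₀≡ (s≤s⁻¹ g₁<g₀)
  sucHead-predHead : ∀ {τ} → indent τ ≗ indent σ′ → indent (sucHead τ) ≗ indent σ
  sucHead-predHead τ≗ zero    = trans (cong suc (τ≗ 0)) (sym g₀≡)
  sucHead-predHead τ≗ (suc y) = τ≗ (suc y)

_≉_ : ∀ {n} → Staircase n → Staircase n → Set
σ ≉ τ = ¬ (indent σ ≗ indent τ)

double-distinct : ∀ {n} {L : List (Staircase (suc n))} → AllPairs _≉_ L → AllPairs _≉_ (double L)
double-distinct {n} {L} distinct = AllPairsₚ.++⁺
  (AllPairsₚ.map⁺ (AllPairs.map (λ σ≉τ eq → σ≉τ (eq ∘ suc)) distinct))
  (AllPairsₚ.map⁺ (AllPairs.map (λ σ≉τ eq → σ≉τ (sucHead-injective eq)) distinct))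
  (Allₚ.map⁺ (All.universal (λ σ → Allₚ.map⁺ (All.universal (repeatHead≉sucHead σ) L)) L))
  where
  sucHead-injective : ∀ {σ τ : Staircase (suc n)} →
                      indent (sucHead σ) ≗ indent (sucHead τ) → indent σ ≗ indent τ
  sucHead-injective eq zero    = suc-injective (eq 0)
  sucHead-injective eq (suc y) = eq (suc y)
  repeatHead≉sucHead : ∀ σ τ → repeatHead σ ≉ sucHead τ
  repeatHead≉sucHead σ τ eq =
    1+n≰n (≤-trans (≤-reflexive (trans (sym (eq 0)) (eq 1))) (Staircase.antitone τ 0))

staircases : ∀ n → List (Staircase n)
staircases zero          = flat ∷ []
staircases (suc zero)    = flat ∷ []
staircases (suc (suc n)) = double (staircases (suc n))

length-staircases : ∀ n → length (staircases (suc n)) ≡ 2 ^ n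
length-staircases zero    = refl
length-staircases (suc n) =
  trans (length-double (staircases (suc n))) (cong (2 *_) (length-staircases n))

staircases-complete : ∀ n (σ : Staircase n) → Any (λ τ → indent τ ≗ indent σ) (staircases n)
staircases-complete zero          σ = here (sym ∘ flat-unique σ z≤n)
staircases-complete (suc zero)    σ = here (sym ∘ flat-unique σ ≤-refl)
staircases-complete (suc (suc n)) σ = double-complete {n} (staircases-complete (suc n)) σ

staircases-distinct : ∀ n → AllPairs _≉_ (staircases n)
staircases-distinct zero          = All.[] ∷ []
staircases-distinct (suc zero)    = All.[] ∷ []
staircases-distinct (suc (suc n)) = double-distinct (staircases-distinct (suc n))

rotInvConvex-count : ∀ n → HasCount (ConvexRotInv (2 * suc n)) (length (staircases n))
rotInvConvex-count n =
  map regionShape (staircases n) , unique , length-map regionShape (staircases n) ,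
  λ s → mk⇔ sound (complete s)
  where
  unique : Unique (map regionShape (staircases n))
  unique = AllPairsₚ.map⁺ (AllPairs.map (λ {σ} {τ} σ≉τ eq → σ≉τ (regionShape-injective {σ = σ} {τ} eq))
                                        (staircases-distinct n))
  sound : ∀ {s} → s ∈ map regionShape (staircases n) → ConvexRotInv (2 * suc n) s
  sound s∈ with ∈-map⁻ regionShape s∈
  ... | σ , _ , refl = regionShape-valid σ
  complete : ∀ s → ConvexRotInv (2 * suc n) s → s ∈ map regionShape (staircases n)
  complete s valid with ConvexRotInv⇒regionShape n s valid
  ... | σ , refl = Anyₚ.map⁺ (Any.map (λ {τ} τ≗σ → sym (regionShape-cong {σ = τ} {σ} τ≗σ))
                                      (staircases-complete n σ))

mainTheorem12 : HasCount (ConvexRotInv 2) 1 ×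
    (∀ m → 2 ≤ m → HasCount (ConvexRotInv (2 * m)) (2 ^ (m ∸ 2)))
mainTheorem12 = rotInvConvex-count 0 , λ where
  (suc (suc k)) (s≤s (s≤s _)) →
    subst (HasCount (ConvexRotInv (2 * suc (suc k)))) (length-staircases k)
          (rotInvConvex-count (suc k))
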